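{- Let $w=a_1^kva_1^m\in M_2$ with $k,m\ge 0$ and $v$ a word with $v_1=v_{fin}=a_2$. Consider the four terms $\rho_v$, $\sigma_k(v)$, $\sigma^m(v)$, $\sigma_k^m(v)$. Each of them lies entirely in $U$ or entirely in $V$. Furthermore, if $|v|>1$ then $\sigma_k(v),\sigma^m(v),\sigma_k^m(v)\in V$; otherwise ($v=a_2$) $\sigma_k(v),\sigma^m(v)\in U$ and $\sigma_k^m(v)\in V$.
   Context: $M_2$ is the free monoid over $\{a_1,a_2\}$; $\rho_u(w)$ counts the (possibly overlapping) occurrences of $u$ in $w$, $\rho_\epsilon(w)=|w|$. $\widehat C$ is the module of counting functions (finite linear combinations of the $\rho_u$ with coefficients in a fixed ring $\mathbb Z,\mathbb Q,\mathbb R$ or $\mathbb C$) modulo bounded functions. $B=\{\rho_w : w_1\ne a_1,\ w_{fin}\ne a_1\}$ (including $\rho_\epsilon$) is a basis of $\widehat C$. $B_U=\{\rho_\epsilon,\rho_{a_2}\}\cup\{\rho_{a_2a_1^ka_2}:k\ge0\}$, $B_V=B\setminus B_U$, $U=\operatorname{span}B_U$, $V=\operatorname{span}B_V$. For $k,m\ge 0$: $\sigma_k(v)=\sum_{i=0}^{k-1}\rho_{a_2a_1^iv}$, $\sigma^m(v)=\sum_{j=0}^{m-1}\rho_{va_1^ja_2}$, $\sigma_k^m(v)=\sum_{i=0}^{k-1}\sum_{j=0}^{m-1}\rho_{a_2a_1^iva_1^ja_2}$ (empty sums are $0$). -}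

module Defs where

open import Data.Nat using (ℕ; zero; suc; _≤_; _<_)
open import Data.Integer using (ℤ; +_; _+_; _-_; ∣_∣)
open import Data.List using (List; []; _∷_; _++_; replicate; length; foldr)
open import Data.List.Relation.Unary.All using (All)
open import Data.Product using (Σ; ∃; ∃-syntax; _×_; _,_; proj₂)
open import Data.Sum using (_⊎_)
open import Data.Bool using (Bool; true; false; _∧_)
open import Relation.Binary.PropositionalEquality using (_≡_)
open import Relation.Nullary using (¬_)

data Letter : Set where
  a₁ a₂ : Letter

_==_ : Letter → Letter → Bool
a₁ == a₁ = true
a₂ == a₂ = true
_  == _  = false

Word : Set
Word = List Letter

isPrefix : Word → Word → Bool
isPrefix []      _       = true
isPrefix (_ ∷ _) []      = false
isPrefix (x ∷ u) (y ∷ w) = (x == y) ∧ isPrefix u w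

occ : Word → Word → ℕ
occ u []      = 0
occ u (y ∷ w) with isPrefix u (y ∷ w)
... | true  = suc (occ u w)
... | false = occ u w

ρ : Word → Word → ℕ
ρ []      w = length w
ρ (x ∷ u) w = occ (x ∷ u) w

-- Counting functions with coefficients in ℤ (the fixed ring).
CountingFun : Set
CountingFun = Word → ℤ

ρℤ : Word → CountingFun
ρℤ u w = + ρ u w

LinComb : Set
LinComb = List (ℤ × Word)

evalLC : LinComb → CountingFun
evalLC c w = foldr (λ { (a , u) s → a Data.Integer.* ρℤ u w + s }) (+ 0) c

Bounded : CountingFun → Set
Bounded f = ∃[ C ] (∀ w → ∣ f w ∣ ≤ C)

-- Basis B and its parts B_U, B_V (as predicates on words u, standing for ρ_u)
InB : Word → Set
InB u = u ≡ [] ⊎ (∃[ u' ] (∃[ x ] (u ≡ x ∷ u' × ¬ (x ≡ a₁)))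
                  × ∃[ u' ] (∃[ x ] (u ≡ u' ++ (x ∷ []) × ¬ (x ≡ a₁))))

InBU : Word → Set
InBU u = u ≡ [] ⊎ (u ≡ a₂ ∷ [] ⊎ ∃[ k ] (u ≡ a₂ ∷ (replicate k a₁ ++ (a₂ ∷ []))))

InBV : Word → Set
InBV u = InB u × ¬ InBU u

-- f (a counting function) lies, in Ĉ = counting functions / bounded functions,
-- in the span of {ρ_u : P u}: f differs by a bounded function from a
-- ℤ-linear combination of such ρ_u.
InSpan : (Word → Set) → CountingFun → Set
InSpan P f = ∃[ c ] (All (λ p → P (proj₂ p)) c × Bounded (λ w → f w - evalLC c w))

InU : CountingFun → Set
InU = InSpan InBU

InV : CountingFun → Set
InV = InSpan InBV

sumTo : ℕ → (ℕ → CountingFun) → CountingFun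
sumTo zero    f w = + 0
sumTo (suc k) f w = sumTo k f w + f k w

σ_ : ℕ → Word → CountingFun
σ_ k v = sumTo k (λ i → ρℤ (a₂ ∷ (replicate i a₁ ++ v)))

σ^ : ℕ → Word → CountingFun
σ^ m v = sumTo m (λ j → ρℤ (v ++ (replicate j a₁ ++ (a₂ ∷ []))))

σ_^ : ℕ → ℕ → Word → CountingFun
σ_^ k m v = sumTo k (λ i → sumTo m (λ j →
  ρℤ (a₂ ∷ (replicate i a₁ ++ (v ++ (replicate j a₁ ++ (a₂ ∷ [])))))))

InUorV : CountingFun → Set
InUorV f = InU f ⊎ InV f

{-# OPTIONS --safe #-}
module Submission where

open import Defs
open import Data.Nat as ℕ using (ℕ; zero; suc; _≤_; _<_; z≤n; s≤s)
open import Data.Nat.Properties using (≤-refl; ≤-trans; ≤-reflexive; m≤n⇒m≤1+n; <⇒≱; +-mono-≤; module ≤-Reasoning)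
open import Data.List using ([]; _∷_; _++_; replicate; length)
open import Data.List.Properties using (++-assoc; ∷-injectiveʳ)
open import Data.List.Relation.Unary.All using ([]; _∷_)
open import Data.List.Relation.Unary.All.Properties using (++⁺)
open import Data.Product using (∃-syntax; _×_; _,_)
open import Data.Sum as Sum using (_⊎_; inj₁; inj₂)
open import Data.Empty using (⊥-elim)
open import Relation.Nullary using (¬_)
open import Data.Integer using (+_; _+_; _-_; -_; _*_; ∣_∣)
open import Data.Integer.Properties
  using (+-identityˡ; +-identityʳ; +-assoc; *-identityˡ; +-inverseʳ; neg-distrib-+; ∣i+j∣≤∣i∣+∣j∣; +-commutativeSemigroup)
open import Algebra.Properties.CommutativeSemigroup +-commutativeSemigroup using (interchange)
open import Relation.Binary.PropositionalEquality using (_≡_; refl; sym; trans; cong; subst; module ≡-Reasoning)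

-- Each of the four terms is a sum of ρ_u over words u = a₂ ⋯ a₂, all of them basis
-- elements, so it lies in U or in V (with zero bounded error) as soon as all its u lie
-- in B_U or all in B_V.  Such a word lies in B_U exactly when it has at most two
-- letters a₂, and the words of σ_k(v) and σ^m(v) for |v| > 1, and of σ_k^m(v) always,
-- have at least three.

+-minus-interchange : ∀ a b c d → (a + b) - (c + d) ≡ (a - c) + (b - d)
+-minus-interchange a b c d = begin
  (a + b) + - (c + d)     ≡⟨ cong (λ z → (a + b) + z) (neg-distrib-+ c d) ⟩
  (a + b) + (- c + - d)   ≡⟨ interchange a b (- c) (- d) ⟩
  (a + - c) + (b + - d)   ∎
  where open ≡-Reasoning

evalLC-++ : ∀ c d w → evalLC (c ++ d) w ≡ evalLC c w + evalLC d w
evalLC-++ []            d w = sym (+-identityˡ _)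
evalLC-++ ((a , u) ∷ c) d w =
  trans (cong (λ z → a * ρℤ u w + z) (evalLC-++ c d w))
        (sym (+-assoc (a * ρℤ u w) _ _))

module _ {P : Word → Set} where

  InSpan-ρ : ∀ {u} → P u → InSpan P (ρℤ u)
  InSpan-ρ {u} pu = ((+ 1 , u) ∷ []) , pu ∷ [] , 0 , λ w → ≤-reflexive (cong ∣_∣ (cancel w))
    where
    cancel : ∀ w → ρℤ u w - (+ 1 * ρℤ u w + + 0) ≡ + 0
    cancel w = trans (cong (λ z → ρℤ u w - z) (trans (+-identityʳ _) (*-identityˡ (ρℤ u w))))
                     (+-inverseʳ (ρℤ u w))

  InSpan-+ : ∀ {f g} → InSpan P f → InSpan P g → InSpan P (λ w → f w + g w)
  InSpan-+ {f} {g} (c , Pc , C , f-c≤C) (d , Pd , D , g-d≤D) =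
    c ++ d , ++⁺ Pc Pd , C ℕ.+ D , bound
    where
    bound : ∀ w → ∣ (f w + g w) - evalLC (c ++ d) w ∣ ≤ C ℕ.+ D
    bound w = begin
      ∣ (f w + g w) - evalLC (c ++ d) w ∣
        ≡⟨ cong (λ z → ∣ (f w + g w) - z ∣) (evalLC-++ c d w) ⟩
      ∣ (f w + g w) - (evalLC c w + evalLC d w) ∣
        ≡⟨ cong ∣_∣ (+-minus-interchange (f w) (g w) _ _) ⟩
      ∣ (f w - evalLC c w) + (g w - evalLC d w) ∣
        ≤⟨ ∣i+j∣≤∣i∣+∣j∣ (f w - evalLC c w) (g w - evalLC d w) ⟩
      ∣ f w - evalLC c w ∣ ℕ.+ ∣ g w - evalLC d w ∣
        ≤⟨ +-mono-≤ (f-c≤C w) (g-d≤D w) ⟩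
      C ℕ.+ D ∎
      where open ≤-Reasoning

  InSpan-sumTo : ∀ k {f : ℕ → CountingFun} → (∀ i → InSpan P (f i)) → InSpan P (sumTo k f)
  InSpan-sumTo zero    _  = [] , [] , 0 , λ _ → z≤n
  InSpan-sumTo (suc k) {f} Pf = InSpan-+ {sumTo k f} {f k} (InSpan-sumTo k Pf) (Pf k)

#a₂ : Word → ℕ
#a₂ []       = 0
#a₂ (a₁ ∷ u) = #a₂ u
#a₂ (a₂ ∷ u) = suc (#a₂ u)

#a₂-++ʳ : ∀ xs ys → #a₂ ys ≤ #a₂ (xs ++ ys)
#a₂-++ʳ []        ys = ≤-refl
#a₂-++ʳ (a₁ ∷ xs) ys = #a₂-++ʳ xs ys
#a₂-++ʳ (a₂ ∷ xs) ys = m≤n⇒m≤1+n (#a₂-++ʳ xs ys)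

#a₂-replicate-a₁-++ : ∀ k ys → #a₂ (replicate k a₁ ++ ys) ≡ #a₂ ys
#a₂-replicate-a₁-++ zero    ys = refl
#a₂-replicate-a₁-++ (suc k) ys = #a₂-replicate-a₁-++ k ys

InBU⇒#a₂≤2 : ∀ {u} → InBU u → #a₂ u ≤ 2
InBU⇒#a₂≤2 (inj₁ refl)              = z≤n
InBU⇒#a₂≤2 (inj₂ (inj₁ refl))       = s≤s z≤n
InBU⇒#a₂≤2 (inj₂ (inj₂ (k , refl))) = s≤s (≤-reflexive (#a₂-replicate-a₁-++ k (a₂ ∷ [])))

EndsInA₂ : Word → Set
EndsInA₂ u = ∃[ u' ] (u ≡ u' ++ a₂ ∷ [])

EndsInA₂-++ : ∀ xs {ys} → EndsInA₂ ys → EndsInA₂ (xs ++ ys)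
EndsInA₂-++ xs (y , refl) = xs ++ y , sym (++-assoc xs y (a₂ ∷ []))

EndsInA₂⇒1≤#a₂ : ∀ {u} → EndsInA₂ u → 1 ≤ #a₂ u
EndsInA₂⇒1≤#a₂ (u' , refl) = #a₂-++ʳ u' (a₂ ∷ [])

InBV-a₂xa₂y : ∀ x {y} → EndsInA₂ y → InBV (a₂ ∷ x ++ a₂ ∷ y)
InBV-a₂xa₂y x {y} y-ends =
  inj₂ (x ++ a₂ ∷ y , (a₂ , refl , λ ()) , ends) , λ inBU → <⇒≱ 2<#a₂ (InBU⇒#a₂≤2 inBU)
  where
  ends : ∃[ u' ] ∃[ l ] (a₂ ∷ x ++ a₂ ∷ y ≡ u' ++ l ∷ [] × ¬ l ≡ a₁)
  ends with EndsInA₂-++ (a₂ ∷ x) (EndsInA₂-++ (a₂ ∷ []) y-ends)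
  ... | u' , eq = u' , a₂ , eq , λ ()
  2<#a₂ : 2 < #a₂ (a₂ ∷ x ++ a₂ ∷ y)
  2<#a₂ = s≤s (≤-trans (s≤s (EndsInA₂⇒1≤#a₂ y-ends)) (#a₂-++ʳ x (a₂ ∷ y)))

a₂-bordered-cases : ∀ {v} → ∃[ v' ] (v ≡ a₂ ∷ v') → EndsInA₂ v
  → v ≡ a₂ ∷ [] ⊎ ∃[ t ] (v ≡ a₂ ∷ t ++ a₂ ∷ [])
a₂-bordered-cases ([]    , refl) _            = inj₁ refl
a₂-bordered-cases (_ ∷ _ , refl) ([]    , ())
a₂-bordered-cases (_ ∷ _ , refl) (_ ∷ t , eq) = inj₂ (t , cong (a₂ ∷_) (∷-injectiveʳ eq))

replicate-a₁⊎a₂-split : ∀ t → ∃[ k ] (t ≡ replicate k a₁) ⊎ ∃[ x ] ∃[ y ] (t ≡ x ++ a₂ ∷ y)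
replicate-a₁⊎a₂-split []       = inj₁ (0 , refl)
replicate-a₁⊎a₂-split (a₂ ∷ t) = inj₂ ([] , t , refl)
replicate-a₁⊎a₂-split (a₁ ∷ t) with replicate-a₁⊎a₂-split t
... | inj₁ (k , refl)     = inj₁ (suc k , refl)
... | inj₂ (x , y , refl) = inj₂ (a₁ ∷ x , y , refl)

InBU⊎InBV-a₂ta₂ : ∀ t → InBU (a₂ ∷ t ++ a₂ ∷ []) ⊎ InBV (a₂ ∷ t ++ a₂ ∷ [])
InBU⊎InBV-a₂ta₂ t with replicate-a₁⊎a₂-split t
... | inj₁ (k , refl)     = inj₁ (inj₂ (inj₂ (k , refl)))
... | inj₂ (x , y , refl) =
  inj₂ (subst InBV (cong (a₂ ∷_) (sym (++-assoc x (a₂ ∷ y) (a₂ ∷ [])))) (InBV-a₂xa₂y x (y , refl)))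

1<length-a₂ta₂ : ∀ t → 1 < length (a₂ ∷ t ++ a₂ ∷ [])
1<length-a₂ta₂ []      = s≤s (s≤s z≤n)
1<length-a₂ta₂ (_ ∷ _) = s≤s (s≤s z≤n)

ρ-a₂ta₂-InUorV : ∀ t → InUorV (ρℤ (a₂ ∷ t ++ a₂ ∷ []))
ρ-a₂ta₂-InUorV t = Sum.map InSpan-ρ InSpan-ρ (InBU⊎InBV-a₂ta₂ t)

σ_-a₂-InU : ∀ k → InU (σ_ k (a₂ ∷ []))
σ_-a₂-InU k = InSpan-sumTo k λ i → InSpan-ρ (inj₂ (inj₂ (i , refl)))

σ^-a₂-InU : ∀ m → InU (σ^ m (a₂ ∷ []))
σ^-a₂-InU m = InSpan-sumTo m λ j → InSpan-ρ (inj₂ (inj₂ (j , refl)))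

σ_-a₂ta₂-InV : ∀ k t → InV (σ_ k (a₂ ∷ t ++ a₂ ∷ []))
σ_-a₂ta₂-InV k t = InSpan-sumTo k λ i → InSpan-ρ (InBV-a₂xa₂y (replicate i a₁) (t , refl))

σ^-a₂ta₂-InV : ∀ m t → InV (σ^ m (a₂ ∷ t ++ a₂ ∷ []))
σ^-a₂ta₂-InV m t = InSpan-sumTo m λ j → InSpan-ρ
  (subst InBV (cong (a₂ ∷_) (sym (++-assoc t (a₂ ∷ []) (replicate j a₁ ++ a₂ ∷ []))))
         (InBV-a₂xa₂y t (replicate j a₁ , refl)))

σ_^-a₂-InV : ∀ k m v' → InV (σ_^ k m (a₂ ∷ v'))
σ_^-a₂-InV k m v' = InSpan-sumTo k λ i → InSpan-sumTo m λ j → InSpan-ρ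
  (InBV-a₂xa₂y (replicate i a₁) (EndsInA₂-++ v' (replicate j a₁ , refl)))

lemma2p4 : (k m : ℕ) (v : Word) (w : Word)
    → w ≡ replicate k a₁ ++ (v ++ replicate m a₁)
    → ∃[ v' ] (v ≡ a₂ ∷ v')
    → ∃[ v' ] (v ≡ v' ++ (a₂ ∷ []))
    → (InUorV (ρℤ v) × InUorV (σ_ k v) × InUorV (σ^ m v) × InUorV (σ_^ k m v))
      × (1 < length v → InV (σ_ k v) × InV (σ^ m v) × InV (σ_^ k m v))
      × (length v ≤ 1 → InU (σ_ k v) × InU (σ^ m v) × InV (σ_^ k m v))
lemma2p4 k m v _ _ starts ends with a₂-bordered-cases starts ends
... | inj₁ refl =
  (inj₁ (InSpan-ρ (inj₂ (inj₁ refl))) , inj₁ (σ_-a₂-InU k) , inj₁ (σ^-a₂-InU m) ,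
   inj₂ (σ_^-a₂-InV k m [])) ,
  (λ { (s≤s ()) }) ,
  λ _ → σ_-a₂-InU k , σ^-a₂-InU m , σ_^-a₂-InV k m []
... | inj₂ (t , refl) =
  (ρ-a₂ta₂-InUorV t , inj₂ (σ_-a₂ta₂-InV k t) , inj₂ (σ^-a₂ta₂-InV m t) ,
   inj₂ (σ_^-a₂-InV k m (t ++ a₂ ∷ []))) ,
  (λ _ → σ_-a₂ta₂-InV k t , σ^-a₂ta₂-InV m t , σ_^-a₂-InV k m (t ++ a₂ ∷ [])) ,
  λ short → ⊥-elim (<⇒≱ (1<length-a₂ta₂ t) short)
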